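{- Let $G$ be a connected loopless multigraph on vertex set $[n]$, let $e$ be an edge of $G$ with endvertices $\{u,v\}$, and let $G'$ be the graph obtained by subdividing $e$: $e$ is replaced by two edges $e',e''$ with endvertices $\{u,w\}$ and $\{v,w\}$ respectively, where $w$ is a new vertex. Then for any edge ordering $\omega$ of $G$ there exists an edge ordering $\omega'$ of $G'$ such that $\ell_{\omega'}=\ell_\omega$.
   Context: For an edge $f$ with endvertices $a,b$ let $\tau_f$ be the transposition $(a\ b)$ of the vertex set. For an edge ordering (linear order of the edge set) $\omega=(e_1,\dots,e_m)$ put $\pi_\omega=\tau_{e_m}\cdots\tau_{e_1}$, a permutation of the vertex set, and let $\ell_\omega$ be the number of orbits of $\langle\pi_\omega\rangle$ on the vertex set (number of cycles of $\pi_\omega$, fixed points included). -}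

module Defs where

open import Data.Nat using (ℕ; zero; suc; _≤_; _≤?_)
open import Data.Fin using (Fin; toℕ; _≟_) renaming (zero to fzero; suc to fsuc)
open import Data.Fin.Permutation using (Permutation′; _⟨$⟩ʳ_)
open import Data.Product using (_×_; _,_; proj₁; proj₂)
open import Data.List using (List; foldl; length; filter; upTo; allFin; tabulate)
open import Data.List.Relation.Unary.All using (All; all?)
open import Relation.Nullary using (¬_; yes; no; Dec)
open import Relation.Binary.PropositionalEquality using (_≡_)
open import Function using (_∘_)

-- A multigraph on vertex set [n] = Fin n with edge set Fin m;
-- each edge has an (arbitrarily oriented) pair of endvertices.
record Multigraph (n m : ℕ) : Set where
  field
    ends : Fin m → Fin n × Fin n

open Multigraph public

Loopless : ∀ {n m} → Multigraph n m → Set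
Loopless G = ∀ i → ¬ (proj₁ (ends G i) ≡ proj₂ (ends G i))

data Reach {n m} (G : Multigraph n m) : Fin n → Fin n → Set where
  here : ∀ {x} → Reach G x x
  fwd  : ∀ {x y} (i : Fin m) → proj₁ (ends G i) ≡ x → Reach G (proj₂ (ends G i)) y → Reach G x y
  bwd  : ∀ {x y} (i : Fin m) → proj₂ (ends G i) ≡ x → Reach G (proj₁ (ends G i)) y → Reach G x y

Connected : ∀ {n m} → Multigraph n m → Set
Connected G = ∀ x y → Reach G x y

-- Vertices of G' are Fin (suc n):
-- the new vertex w is fzero, old vertex x becomes fsuc x.  Edges of G' are Fin (suc m):
-- old edge i becomes fsuc i, where fsuc e is e' with ends (u , w);
-- the new edge fzero is e'' with ends (v , w).
subdivide : ∀ {n m} → Multigraph n m → Fin m → Multigraph (suc n) (suc m)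
ends (subdivide G e) fzero = fsuc (proj₂ (ends G e)) , fzero
ends (subdivide G e) (fsuc i) with i ≟ e
... | yes _ = fsuc (proj₁ (ends G e)) , fzero
... | no  _ = fsuc (proj₁ (ends G i)) , fsuc (proj₂ (ends G i))

transp : ∀ {n} → Fin n → Fin n → Fin n → Fin n
transp a b x with x ≟ a
... | yes _ = b
... | no _ with x ≟ b
...   | yes _ = a
...   | no _ = x

τ : ∀ {n m} → Multigraph n m → Fin m → Fin n → Fin n
τ G f = transp (proj₁ (ends G f)) (proj₂ (ends G f))

-- An edge ordering: a bijection ω of Fin m, e_{k+1} = ω ⟨$⟩ʳ k.
EdgeOrdering : ℕ → Set
EdgeOrdering m = Permutation′ m

edgeSeq : ∀ {m} → EdgeOrdering m → List (Fin m)
edgeSeq ω = tabulate (ω ⟨$⟩ʳ_)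

πω : ∀ {n m} → Multigraph n m → EdgeOrdering m → Fin n → Fin n
πω G ω x = foldl (λ y f → τ G f y) x (edgeSeq ω)

iter : ∀ {n} → (Fin n → Fin n) → ℕ → Fin n → Fin n
iter p zero x = x
iter p (suc k) x = p (iter p k x)

-- x is the least element of its ⟨p⟩-orbit (the orbit of x is {p^k x | k < n})
IsOrbitMin : ∀ {n} → (Fin n → Fin n) → Fin n → Set
IsOrbitMin {n} p x = All (λ k → toℕ x ≤ toℕ (iter p k x)) (upTo n)

isOrbitMin? : ∀ {n} (p : Fin n → Fin n) (x : Fin n) → Dec (IsOrbitMin p x)
isOrbitMin? {n} p x = all? (λ k → toℕ x ≤? toℕ (iter p k x)) (upTo n)

-- number of orbits of ⟨p⟩ on Fin n (one least element per orbit), for p a permutation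
numOrbits : ∀ {n} → (Fin n → Fin n) → ℕ
numOrbits {n} p = length (filter (isOrbitMin? p) (allFin n))

ℓ : ∀ {n m} → Multigraph n m → EdgeOrdering m → ℕ
ℓ G ω = numOrbits (πω G ω)

-- Order ω′ like ω, with e′ in the place of e and e″ right after it. The product
-- τ_{e″} τ_{e′} = (v w)(u w) is the cycle u ↦ v ↦ w ↦ u, i.e. τ_e = (u v) with the
-- new vertex w inserted into its cycle right after v (this needs u ≠ v). Composing
-- with the transpositions of the remaining edges, which fix w, keeps w inserted right
-- after a single vertex, so π_{ω′} is π_ω with w put into one of its cycles, and the
-- number of cycles does not change.
module Submission where

open import Defs
open import Data.Empty using (⊥-elim)
open import Data.Fin using (Fin; toℕ; _≟_; punchIn) renaming (zero to fzero; suc to fsuc)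
open import Data.Fin.Permutation using (insert; insert-punchIn; _⟨$⟩ʳ_; _⟨$⟩ˡ_; inverseʳ; inverseˡ)
open import Data.Fin.Properties using (suc-injective; toℕ-injective; toℕ<n; pigeonhole; 0≢1+n)
open import Data.List using (List; []; _∷_; map; filter; length; tabulate; allFin; upTo; foldl)
open import Data.List.Properties using (filter-accept; filter-reject; filter-none; filter-≐; map-tabulate; tabulate-cong)
open import Data.List.Membership.Propositional using (_∈_)
open import Data.List.Membership.Propositional.Properties using (∈-allFin)
open import Data.List.Relation.Unary.All as All using (All; []; _∷_)
open import Data.List.Relation.Unary.All.Properties using (applyUpTo⁺₂; applyUpTo⁻; ¬All⇒Any¬; tabulate⁺)
open import Data.List.Relation.Unary.AllPairs using ([]; _∷_)
open import Data.List.Relation.Unary.Any using (here; there; any?; satisfied)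
open import Data.List.Relation.Unary.Any.Properties using (applyUpTo⁺)
open import Data.List.Relation.Unary.Unique.Propositional using (Unique)
open import Data.List.Relation.Unary.Unique.Propositional.Properties using (allFin⁺)
open import Data.Nat using (ℕ; zero; suc; _+_; _*_; _∸_; _≤_; _<_; _≤?_; z≤n; s≤s; NonZero; >-nonZero)
open import Data.Nat.DivMod using (_%_; _/_; m≡m%n+[m/n]*n; m%n<n)
open import Data.Nat.Induction using (<-wellFounded)
open import Data.Nat.Properties
  using (≤-pred; n<1+n; ≤-trans; <⇒≤; <-≤-trans; ≤-antisym; ≰⇒>; +-suc; m<n⇒0<n∸m; m∸n≤m; m+[n∸m]≡n; m∸n+n≡m)
open import Data.Product using (∃; _×_; _,_; proj₁; proj₂)
open import Function using (_∘_; id)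
open import Function.Definitions using (Injective)
open import Induction.WellFounded using (Acc; acc)
open import Relation.Nullary using (¬_; yes; no; Dec; contradiction)
open import Relation.Unary using (Decidable; _∩_; ∁; _≐_)
open import Relation.Unary.Properties using (_∩?_; ∁?)
open import Relation.Binary.PropositionalEquality
  using (_≡_; _≢_; refl; sym; trans; cong; cong₂; subst; subst₂; _≗_; module ≡-Reasoning)

open ≡-Reasoning

transp-left : ∀ {n} (a b : Fin n) → transp a b a ≡ b
transp-left a b with a ≟ a
... | yes _ = refl
... | no a≢a = ⊥-elim (a≢a refl)

transp-right : ∀ {n} (a b : Fin n) → transp a b b ≡ a
transp-right a b with b ≟ a
... | yes b≡a = b≡a
... | no _ with b ≟ b
...   | yes _ = refl
...   | no b≢b = ⊥-elim (b≢b refl)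

transp-other : ∀ {n} {a b x : Fin n} → x ≢ a → x ≢ b → transp a b x ≡ x
transp-other {a = a} {b} {x} x≢a x≢b with x ≟ a
... | yes x≡a = ⊥-elim (x≢a x≡a)
... | no _ with x ≟ b
...   | yes x≡b = ⊥-elim (x≢b x≡b)
...   | no _ = refl

transp-involutive : ∀ {n} (a b x : Fin n) → transp a b (transp a b x) ≡ x
transp-involutive a b x = cases (x ≟ a) (x ≟ b)
  where
  cases : Dec (x ≡ a) → Dec (x ≡ b) → transp a b (transp a b x) ≡ x
  cases (yes refl) _ = trans (cong (transp a b) (transp-left a b)) (transp-right a b)
  cases (no _) (yes refl) = trans (cong (transp a b) (transp-right a b)) (transp-left a b)
  cases (no x≢a) (no x≢b) = trans (cong (transp a b) (transp-other x≢a x≢b)) (transp-other x≢a x≢b)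

lift : ∀ {n} → (Fin n → Fin n) → Fin (suc n) → Fin (suc n)
lift f fzero = fzero
lift f (fsuc x) = fsuc (f x)

lift-∘ : ∀ {n} (f g : Fin n → Fin n) → lift f ∘ lift g ≗ lift (f ∘ g)
lift-∘ f g fzero = refl
lift-∘ f g (fsuc x) = refl

transp-lift : ∀ {n} (a b : Fin n) → transp (fsuc a) (fsuc b) ≗ lift (transp a b)
transp-lift a b fzero = transp-other {a = fsuc a} {fsuc b} (λ ()) (λ ())
transp-lift a b (fsuc y) = cases (y ≟ a) (y ≟ b)
  where
  cases : Dec (y ≡ a) → Dec (y ≡ b) → transp (fsuc a) (fsuc b) (fsuc y) ≡ fsuc (transp a b y)
  cases (yes refl) _ = trans (transp-left (fsuc a) (fsuc b)) (cong fsuc (sym (transp-left a b)))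
  cases (no _) (yes refl) = trans (transp-right (fsuc a) (fsuc b)) (cong fsuc (sym (transp-right a b)))
  cases (no y≢a) (no y≢b) =
    trans (transp-other (y≢a ∘ suc-injective) (y≢b ∘ suc-injective)) (cong fsuc (sym (transp-other y≢a y≢b)))

module Orbits {N : ℕ} (q : Fin N → Fin N) (q-injective : Injective _≡_ _≡_ q) where

  iter-+ : ∀ a b y → iter q (a + b) y ≡ iter q a (iter q b y)
  iter-+ zero b y = refl
  iter-+ (suc a) b y = cong q (iter-+ a b y)

  iter-injective : ∀ k → Injective _≡_ _≡_ (iter q k)
  iter-injective zero eq = eq
  iter-injective (suc k) eq = iter-injective k (q-injective eq)

  iter-periodic : ∀ {d y} → iter q d y ≡ y → ∀ t → iter q (t * d) y ≡ y
  iter-periodic per zero = refl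
  iter-periodic {d} {y} per (suc t) =
    trans (iter-+ d (t * d) y) (trans (cong (iter q d) (iter-periodic per t)) per)

  iter-mod : ∀ {d y} .{{_ : NonZero d}} → iter q d y ≡ y → ∀ k → iter q k y ≡ iter q (k % d) y
  iter-mod {d} {y} per k = begin
    iter q k y                              ≡⟨ cong (λ j → iter q j y) (m≡m%n+[m/n]*n k d) ⟩
    iter q (k % d + (k / d) * d) y          ≡⟨ iter-+ (k % d) _ y ⟩
    iter q (k % d) (iter q ((k / d) * d) y) ≡⟨ cong (iter q (k % d)) (iter-periodic per (k / d)) ⟩
    iter q (k % d) y                        ∎

  period : ∀ y → ∃ λ d → 0 < d × d ≤ N × iter q d y ≡ y
  period y with pigeonhole (n<1+n N) (λ (k : Fin (suc N)) → iter q (toℕ k) y)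
  ... | i , j , i<j , same =
    toℕ j ∸ toℕ i , m<n⇒0<n∸m i<j , ≤-trans (m∸n≤m (toℕ j) (toℕ i)) (≤-pred (toℕ<n j)) , sym returns
    where
    returns : y ≡ iter q (toℕ j ∸ toℕ i) y
    returns = iter-injective (toℕ i) (begin
      iter q (toℕ i) y                          ≡⟨ same ⟩
      iter q (toℕ j) y                          ≡⟨ cong (λ k → iter q k y) (m+[n∸m]≡n (<⇒≤ i<j)) ⟨
      iter q (toℕ i + (toℕ j ∸ toℕ i)) y        ≡⟨ iter-+ (toℕ i) _ y ⟩
      iter q (toℕ i) (iter q (toℕ j ∸ toℕ i) y) ∎)

  infix 4 _↝_ _↝?_

  _↝_ : Fin N → Fin N → Set
  y ↝ z = ∃ λ k → iter q k y ≡ z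

  ↝-refl : ∀ {y} → y ↝ y
  ↝-refl = 0 , refl

  ↝-trans : ∀ {x y z} → x ↝ y → y ↝ z → x ↝ z
  ↝-trans {x} (k , refl) (l , refl) = l + k , iter-+ l k x

  ↝-along : ∀ {M} {f : Fin M → Fin M} (h : Fin M → Fin N) → (∀ s → h s ↝ h (f s)) →
            ∀ k s → h s ↝ h (iter f k s)
  ↝-along h step zero s = ↝-refl
  ↝-along {f = f} h step (suc k) s = ↝-trans (↝-along h step k s) (step (iter f k s))

  ↝-short : ∀ {y z} → y ↝ z → ∃ λ r → r < N × iter q r y ≡ z
  ↝-short {y} (k , refl) with period y
  ... | d , 0<d , d≤N , per = k % d , <-≤-trans (m%n<n k d) d≤N , sym (iter-mod per k)
    where instance _ = >-nonZero 0<d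

  ↝-sym : ∀ {y z} → y ↝ z → z ↝ y
  ↝-sym {y} (k , refl) with period y
  ... | d , 0<d , _ , per = d ∸ k % d , (begin
    iter q (d ∸ k % d) (iter q k y)       ≡⟨ cong (iter q (d ∸ k % d)) (iter-mod per k) ⟩
    iter q (d ∸ k % d) (iter q (k % d) y) ≡⟨ iter-+ (d ∸ k % d) (k % d) y ⟨
    iter q (d ∸ k % d + k % d) y          ≡⟨ cong (λ j → iter q j y) (m∸n+n≡m (<⇒≤ (m%n<n k d))) ⟩
    iter q d y                            ≡⟨ per ⟩
    y                                     ∎)
    where instance _ = >-nonZero 0<d

  _↝?_ : ∀ y z → Dec (y ↝ z)
  y ↝? z with any? (λ k → iter q k y ≟ z) (upTo N)
  ... | yes found = yes (satisfied found)
  ... | no none = no λ y↝z → let r , r<N , reached = ↝-short y↝z in none (applyUpTo⁺ id reached r<N)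

  isOrbitMin⇒minimal : ∀ {y z} → IsOrbitMin q y → y ↝ z → toℕ y ≤ toℕ z
  isOrbitMin⇒minimal min y↝z with ↝-short y↝z
  ... | r , r<N , refl = applyUpTo⁻ id N min r<N

  minimal⇒isOrbitMin : ∀ {y} → (∀ {z} → y ↝ z → toℕ y ≤ toℕ z) → IsOrbitMin q y
  minimal⇒isOrbitMin min = applyUpTo⁺₂ id N (λ k → min (k , refl))

  ¬isOrbitMin⇒smaller : ∀ {y} → ¬ IsOrbitMin q y → ∃ λ z → y ↝ z × toℕ z < toℕ y
  ¬isOrbitMin⇒smaller {y} ¬min with satisfied (¬All⇒Any¬ (λ k → toℕ y ≤? toℕ (iter q k y)) (upTo N) ¬min)
  ... | k , y≰ = iter q k y , (k , refl) , ≰⇒> y≰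

  orbitMin-exists : ∀ x → ∃ λ a → IsOrbitMin q a × a ↝ x
  orbitMin-exists x = descend x (<-wellFounded (toℕ x))
    where
    descend : ∀ y → Acc _<_ (toℕ y) → ∃ λ a → IsOrbitMin q a × a ↝ y
    descend y (acc smaller) with isOrbitMin? q y
    ... | yes min = y , min , ↝-refl
    ... | no ¬min with ¬isOrbitMin⇒smaller ¬min
    ...   | z , y↝z , z<y with descend z (smaller z<y)
    ...     | a , min , a↝z = a , min , ↝-trans a↝z (↝-sym y↝z)

  orbitMin-unique : ∀ {a b x} → IsOrbitMin q a × a ↝ x → IsOrbitMin q b × b ↝ x → a ≡ b
  orbitMin-unique (amin , a↝x) (bmin , b↝x) = toℕ-injective (≤-antisym
    (isOrbitMin⇒minimal amin (↝-trans a↝x (↝-sym b↝x)))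
    (isOrbitMin⇒minimal bmin (↝-trans b↝x (↝-sym a↝x))))

module _ {A : Set} {P : A → Set} (P? : Decidable P) where

  length-filter-map : ∀ {B : Set} (f : B → A) xs →
                      length (filter P? (map f xs)) ≡ length (filter (λ b → P? (f b)) xs)
  length-filter-map f [] = refl
  length-filter-map f (x ∷ xs) with P? (f x)
  ... | yes _ = cong suc (length-filter-map f xs)
  ... | no _ = length-filter-map f xs

  length-filter-split : ∀ {Q : A → Set} (Q? : Decidable Q) xs →
    length (filter P? xs) ≡ length (filter (P? ∩? Q?) xs) + length (filter (P? ∩? ∁? Q?) xs)
  length-filter-split Q? [] = refl
  length-filter-split Q? (x ∷ xs) with P? x | Q? x
  ... | yes _ | yes _ = cong suc (length-filter-split Q? xs)
  ... | yes _ | no _ = trans (cong suc (length-filter-split Q? xs)) (sym (+-suc _ _))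
  ... | no _ | _ = length-filter-split Q? xs

  length-filter-unique : (∀ {a b} → P a → P b → a ≡ b) →
                         ∀ {a xs} → Unique xs → a ∈ xs → P a → length (filter P? xs) ≡ 1
  length-filter-unique P-unique (x≢xs ∷ _) (here refl) pa = cong length (trans
    (filter-accept P? pa)
    (cong (_ ∷_) (filter-none P? (All.map (λ x≢y py → x≢y (P-unique pa py)) x≢xs))))
  length-filter-unique P-unique (x≢xs ∷ unique) (there a∈xs) pa = trans
    (cong length (filter-reject P? (λ px → All.lookup x≢xs a∈xs (P-unique px pa))))
    (length-filter-unique P-unique unique a∈xs pa)

-- p′ is p with the new point fzero inserted into the cycle of x right after x.
record CycleInsertion {n} (p′ : Fin (suc n) → Fin (suc n)) (p : Fin n → Fin n) (x : Fin n) : Set where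
  field
    from-new  : p′ fzero ≡ fsuc (p x)
    to-new    : p′ (fsuc x) ≡ fzero
    elsewhere : ∀ {y} → y ≢ x → p′ (fsuc y) ≡ fsuc (p y)

module _ {n} {p′ : Fin (suc n) → Fin (suc n)} {p : Fin n → Fin n} {x : Fin n} where

  open CycleInsertion

  CycleInsertion-resp : ∀ {q′} → p′ ≗ q′ → CycleInsertion p′ p x → CycleInsertion q′ p x
  CycleInsertion-resp p′≗q′ ins .from-new = trans (sym (p′≗q′ _)) (ins .from-new)
  CycleInsertion-resp p′≗q′ ins .to-new = trans (sym (p′≗q′ _)) (ins .to-new)
  CycleInsertion-resp p′≗q′ ins .elsewhere y≢x = trans (sym (p′≗q′ _)) (ins .elsewhere y≢x)

  CycleInsertion-postcompose : ∀ σ → CycleInsertion p′ p x → CycleInsertion (lift σ ∘ p′) (σ ∘ p) x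
  CycleInsertion-postcompose σ ins .from-new = cong (lift σ) (ins .from-new)
  CycleInsertion-postcompose σ ins .to-new = cong (lift σ) (ins .to-new)
  CycleInsertion-postcompose σ ins .elsewhere y≢x = cong (lift σ) (ins .elsewhere y≢x)

  CycleInsertion-precompose : ∀ ρ → (∀ y → ρ (ρ y) ≡ y) →
                              CycleInsertion p′ p x → CycleInsertion (p′ ∘ lift ρ) (p ∘ ρ) (ρ x)
  CycleInsertion-precompose ρ ρρ ins .from-new = trans (ins .from-new) (cong (fsuc ∘ p) (sym (ρρ x)))
  CycleInsertion-precompose ρ ρρ ins .to-new = trans (cong (p′ ∘ fsuc) (ρρ x)) (ins .to-new)
  CycleInsertion-precompose ρ ρρ ins .elsewhere {y} y≢ρx =
    ins .elsewhere (λ ρy≡x → y≢ρx (trans (sym (ρρ y)) (cong ρ ρy≡x)))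

  CycleInsertion-injective : Injective _≡_ _≡_ p → CycleInsertion p′ p x → Injective _≡_ _≡_ p′
  CycleInsertion-injective p-injective ins {s} {t} = cases s t
    where
    cases : ∀ s t → p′ s ≡ p′ t → s ≡ t
    cases fzero fzero _ = refl
    cases fzero (fsuc t) eq with t ≟ x
    ... | yes refl = contradiction (trans (sym (ins .from-new)) (trans eq (ins .to-new))) λ ()
    ... | no t≢x = contradiction
      (p-injective (suc-injective (trans (sym (ins .elsewhere t≢x)) (trans (sym eq) (ins .from-new))))) t≢x
    cases (fsuc s) fzero eq = sym (cases fzero (fsuc s) (sym eq))
    cases (fsuc s) (fsuc t) eq with s ≟ x | t ≟ x
    ... | yes refl | yes refl = refl
    ... | yes refl | no t≢x = contradiction (trans (sym (ins .to-new)) (trans eq (ins .elsewhere t≢x))) λ ()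
    ... | no s≢x | yes refl = contradiction (trans (sym (ins .elsewhere s≢x)) (trans eq (ins .to-new))) λ ()
    ... | no s≢x | no t≢x =
      cong fsuc (p-injective (suc-injective (trans (sym (ins .elsewhere s≢x)) (trans eq (ins .elsewhere t≢x)))))

transp-cycleInsertion : ∀ {n} {u v : Fin n} → u ≢ v →
                        CycleInsertion (transp (fsuc v) fzero ∘ transp (fsuc u) fzero) (transp u v) v
transp-cycleInsertion {u = u} {v} u≢v = record
  { from-new = begin
      transp (fsuc v) fzero (transp (fsuc u) fzero fzero) ≡⟨ cong (transp (fsuc v) fzero) (transp-right (fsuc u) fzero) ⟩
      transp (fsuc v) fzero (fsuc u)                       ≡⟨ transp-other (u≢v ∘ suc-injective) (λ ()) ⟩
      fsuc u                                               ≡⟨ cong fsuc (transp-right u v) ⟨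
      fsuc (transp u v v)                                  ∎
  ; to-new = begin
      transp (fsuc v) fzero (transp (fsuc u) fzero (fsuc v)) ≡⟨ cong (transp (fsuc v) fzero) v-fixed ⟩
      transp (fsuc v) fzero (fsuc v)                         ≡⟨ transp-left (fsuc v) fzero ⟩
      fzero                                                  ∎
  ; elsewhere = λ {y} y≢v → elsewhere y≢v (y ≟ u)
  }
  where
  v-fixed : transp (fsuc u) fzero (fsuc v) ≡ fsuc v
  v-fixed = transp-other (u≢v ∘ sym ∘ suc-injective) (λ ())
  elsewhere : ∀ {y} → y ≢ v → Dec (y ≡ u) →
              transp (fsuc v) fzero (transp (fsuc u) fzero (fsuc y)) ≡ fsuc (transp u v y)
  elsewhere y≢v (yes refl) = begin
    transp (fsuc v) fzero (transp (fsuc u) fzero (fsuc u)) ≡⟨ cong (transp (fsuc v) fzero) (transp-left (fsuc u) fzero) ⟩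
    transp (fsuc v) fzero fzero                            ≡⟨ transp-right (fsuc v) fzero ⟩
    fsuc v                                                 ≡⟨ cong fsuc (transp-left u v) ⟨
    fsuc (transp u v u)                                    ∎
  elsewhere {y} y≢v (no y≢u) = begin
    transp (fsuc v) fzero (transp (fsuc u) fzero (fsuc y)) ≡⟨ cong (transp (fsuc v) fzero) (transp-other (y≢u ∘ suc-injective) (λ ())) ⟩
    transp (fsuc v) fzero (fsuc y)                         ≡⟨ transp-other (y≢v ∘ suc-injective) (λ ()) ⟩
    fsuc y                                                 ≡⟨ cong fsuc (transp-other y≢u y≢v) ⟨
    fsuc (transp u v y)                                    ∎

module _ {n} {p′ : Fin (suc n) → Fin (suc n)} {p : Fin n → Fin n} {x : Fin n}
         (p-injective : Injective _≡_ _≡_ p) (ins : CycleInsertion p′ p x) where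

  open CycleInsertion ins
  private
    module O = Orbits p p-injective
    module O′ = Orbits p′ (CycleInsertion-injective p-injective ins)

  fsuc-↝ : ∀ {y z} → y O.↝ z → fsuc y O′.↝ fsuc z
  fsuc-↝ {y} (k , refl) = O′.↝-along fsuc step k y
    where
    step : ∀ z → fsuc z O′.↝ fsuc (p z)
    step z with z ≟ x
    ... | yes refl = 2 , trans (cong p′ to-new) from-new
    ... | no z≢x = 1 , elsewhere z≢x

  collapse : Fin (suc n) → Fin n
  collapse fzero = x
  collapse (fsuc y) = y

  collapse-↝ : ∀ {s t} → s O′.↝ t → collapse s O.↝ collapse t
  collapse-↝ {s} (k , refl) = O.↝-along collapse step k s
    where
    step : ∀ s → collapse s O.↝ collapse (p′ s)
    step fzero = 1 , sym (cong collapse from-new)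
    step (fsuc y) with y ≟ x
    ... | yes refl = 0 , sym (cong collapse to-new)
    ... | no y≢x = 1 , sym (cong collapse (elsewhere y≢x))

  isOrbitMin-fsuc : (IsOrbitMin p′ ∘ fsuc) ≐ (IsOrbitMin p ∩ ∁ (O._↝ x))
  isOrbitMin-fsuc = to , from
    where
    to : ∀ {y} → IsOrbitMin p′ (fsuc y) → IsOrbitMin p y × ¬ y O.↝ x
    to min′ = O.minimal⇒isOrbitMin (λ y↝z → ≤-pred (O′.isOrbitMin⇒minimal min′ (fsuc-↝ y↝z)))
            , λ y↝x → contradiction (O′.isOrbitMin⇒minimal min′ (O′.↝-trans (fsuc-↝ y↝x) (1 , to-new))) λ ()
    from : ∀ {y} → IsOrbitMin p y × ¬ y O.↝ x → IsOrbitMin p′ (fsuc y)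
    from {y} (min , y↛x) = O′.minimal⇒isOrbitMin bound
      where
      bound : ∀ {t} → fsuc y O′.↝ t → toℕ (fsuc y) ≤ toℕ t
      bound {fzero} y↝new = ⊥-elim (y↛x (collapse-↝ y↝new))
      bound {fsuc z} y↝z = s≤s (O.isOrbitMin⇒minimal min (collapse-↝ y↝z))

  -- fzero becomes the minimum of the orbit of x, whose old minimum is no longer counted.
  numOrbits-cycleInsertion : numOrbits p′ ≡ numOrbits p
  numOrbits-cycleInsertion = begin
    numOrbits p′
      ≡⟨ cong length (filter-accept (isOrbitMin? p′) (O′.minimal⇒isOrbitMin (λ _ → z≤n))) ⟩
    suc (length (filter (isOrbitMin? p′) (tabulate fsuc)))
      ≡⟨ cong (λ xs → suc (length (filter (isOrbitMin? p′) xs))) (map-tabulate id fsuc) ⟨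
    suc (length (filter (isOrbitMin? p′) (map fsuc (allFin n))))
      ≡⟨ cong suc (length-filter-map (isOrbitMin? p′) fsuc (allFin n)) ⟩
    suc (length (filter (isOrbitMin? p′ ∘ fsuc) (allFin n)))
      ≡⟨ cong (suc ∘ length) (filter-≐ _ _ isOrbitMin-fsuc (allFin n)) ⟩
    suc (length (filter (isOrbitMin? p ∩? ∁? (O._↝? x)) (allFin n)))
      ≡⟨ cong (_+ length (filter (isOrbitMin? p ∩? ∁? (O._↝? x)) (allFin n))) orbitOfx-count ⟨
    length (filter (isOrbitMin? p ∩? (O._↝? x)) (allFin n)) + length (filter (isOrbitMin? p ∩? ∁? (O._↝? x)) (allFin n))
      ≡⟨ length-filter-split (isOrbitMin? p) (O._↝? x) (allFin n) ⟨
    numOrbits p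
      ∎
    where
    orbitOfx-count : length (filter (isOrbitMin? p ∩? (O._↝? x)) (allFin n)) ≡ 1
    orbitOfx-count with O.orbitMin-exists x
    ... | a , min-of-x = length-filter-unique _ O.orbitMin-unique (allFin⁺ n) (∈-allFin a) min-of-x

applySeq : ∀ {n m} → Multigraph n m → List (Fin m) → Fin n → Fin n
applySeq G L x = foldl (λ y f → τ G f y) x L

applySeq-injective : ∀ {n m} (G : Multigraph n m) L → Injective _≡_ _≡_ (applySeq G L)
applySeq-injective G [] eq = eq
applySeq-injective G (f ∷ L) {a} {b} eq = begin
  a                     ≡⟨ τ-involutive a ⟨
  τ G f (τ G f a)       ≡⟨ cong (τ G f) (applySeq-injective G L eq) ⟩
  τ G f (τ G f b)       ≡⟨ τ-involutive b ⟩
  b                     ∎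
  where
  τ-involutive : ∀ z → τ G f (τ G f z) ≡ z
  τ-involutive = transp-involutive (proj₁ (ends G f)) (proj₂ (ends G f))

module _ {n m} (G : Multigraph n m) (e : Fin m) where

  private
    G′ = subdivide G e
    u = proj₁ (ends G e)
    v = proj₂ (ends G e)

  τ-subdivide-other : ∀ {a} → a ≢ e → τ G′ (fsuc a) ≗ lift (τ G a)
  τ-subdivide-other {a} a≢e s with a ≟ e
  ... | yes a≡e = ⊥-elim (a≢e a≡e)
  ... | no _ = transp-lift (proj₁ (ends G a)) (proj₂ (ends G a)) s

  τ-subdivide-e : τ G′ (fsuc e) ≗ transp (fsuc u) fzero
  τ-subdivide-e s with e ≟ e
  ... | yes _ = refl
  ... | no e≢e = ⊥-elim (e≢e refl)

  applySeq-lift : ∀ {L} → All (_≢ e) L → applySeq G′ (map fsuc L) ≗ lift (applySeq G L)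
  applySeq-lift [] fzero = refl
  applySeq-lift [] (fsuc _) = refl
  applySeq-lift {a ∷ L} (a≢e ∷ L≢e) s = begin
    applySeq G′ (map fsuc L) (τ G′ (fsuc a) s)   ≡⟨ cong (applySeq G′ (map fsuc L)) (τ-subdivide-other a≢e s) ⟩
    applySeq G′ (map fsuc L) (lift (τ G a) s)    ≡⟨ applySeq-lift L≢e (lift (τ G a) s) ⟩
    lift (applySeq G L) (lift (τ G a) s)         ≡⟨ lift-∘ (applySeq G L) (τ G a) s ⟩
    lift (applySeq G (a ∷ L)) s                  ∎

  data SubdividedSeq : List (Fin (suc m)) → List (Fin m) → Set where
    skip  : ∀ {a L′ L} → a ≢ e → SubdividedSeq L′ L → SubdividedSeq (fsuc a ∷ L′) (a ∷ L)
    split : ∀ {L} → All (_≢ e) L → SubdividedSeq (fsuc e ∷ fzero ∷ map fsuc L) (e ∷ L)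

  applySeq-cycleInsertion : Loopless G → ∀ {L′ L} → SubdividedSeq L′ L →
                            ∃ λ x → CycleInsertion (applySeq G′ L′) (applySeq G L) x
  applySeq-cycleInsertion loopless (skip {a} {L′} a≢e sub) with applySeq-cycleInsertion loopless sub
  ... | x , ins = τ G a x , CycleInsertion-resp
    (λ s → cong (applySeq G′ L′) (sym (τ-subdivide-other a≢e s)))
    (CycleInsertion-precompose (τ G a) (transp-involutive (proj₁ (ends G a)) (proj₂ (ends G a))) ins)
  applySeq-cycleInsertion loopless (split {L} L≢e) = v , CycleInsertion-resp
    (λ s → trans (sym (applySeq-lift L≢e _)) (cong (applySeq G′ (map fsuc L) ∘ τ G′ fzero) (sym (τ-subdivide-e s))))
    (CycleInsertion-postcompose (applySeq G L) (transp-cycleInsertion (loopless e)))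

  tabulate-subdivided : ∀ {k} {f : Fin k → Fin m} {g : Fin (suc k) → Fin (suc m)} (i : Fin k) →
                        f i ≡ e → (∀ {j} → f j ≡ e → j ≡ i) →
                        g (fsuc i) ≡ fzero → (∀ j → g (punchIn (fsuc i) j) ≡ fsuc (f j)) →
                        SubdividedSeq (tabulate g) (tabulate f)
  tabulate-subdivided {f = f} {g} fzero fi≡e e-once gi≡new g-elsewhere =
    subst₂ SubdividedSeq
      (cong₂ _∷_ (sym (trans (g-elsewhere fzero) (cong fsuc fi≡e)))
        (cong₂ _∷_ (sym gi≡new) (trans (map-tabulate (f ∘ fsuc) fsuc) (sym (tabulate-cong (g-elsewhere ∘ fsuc))))))
      (cong (_∷ _) (sym fi≡e))
      (split (tabulate⁺ (λ j f1+j≡e → 0≢1+n (sym (e-once f1+j≡e)))))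
  tabulate-subdivided {f = f} {g} (fsuc i) fi≡e e-once gi≡new g-elsewhere =
    subst (λ g₀ → SubdividedSeq (g₀ ∷ tabulate (g ∘ fsuc)) (tabulate f)) (sym (g-elsewhere fzero))
      (skip (λ f0≡e → 0≢1+n (e-once f0≡e))
        (tabulate-subdivided {g = g ∘ fsuc} i fi≡e (λ eq → suc-injective (e-once eq)) gi≡new (g-elsewhere ∘ fsuc)))

  subdivisionOrdering : EdgeOrdering m → EdgeOrdering (suc m)
  subdivisionOrdering ω = insert (fsuc (ω ⟨$⟩ˡ e)) fzero ω

  edgeSeq-subdivisionOrdering : ∀ ω → SubdividedSeq (edgeSeq (subdivisionOrdering ω)) (edgeSeq ω)
  edgeSeq-subdivisionOrdering ω = tabulate-subdivided {g = subdivisionOrdering ω ⟨$⟩ʳ_} (ω ⟨$⟩ˡ e) (inverseʳ ω)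
    (λ eq → trans (sym (inverseˡ ω)) (cong (ω ⟨$⟩ˡ_) eq)) e″-placed (insert-punchIn (fsuc (ω ⟨$⟩ˡ e)) fzero ω)
    where
    e″-placed : subdivisionOrdering ω ⟨$⟩ʳ fsuc (ω ⟨$⟩ˡ e) ≡ fzero
    e″-placed with fsuc (ω ⟨$⟩ˡ e) ≟ fsuc (ω ⟨$⟩ˡ e)
    ... | yes _ = refl
    ... | no i≢i = ⊥-elim (i≢i refl)

proposition2p2 : ∀ {n m : ℕ} (G : Multigraph n m) → Loopless G → Connected G →
                 (e : Fin m) (ω : EdgeOrdering m) →
                 ∃ (λ (ω′ : EdgeOrdering (suc m)) → ℓ (subdivide G e) ω′ ≡ ℓ G ω)
proposition2p2 G loopless _ e ω
  with applySeq-cycleInsertion G e loopless (edgeSeq-subdivisionOrdering G e ω)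
... | _ , ins = subdivisionOrdering G e ω , numOrbits-cycleInsertion (applySeq-injective G (edgeSeq ω)) ins
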